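{- Let $q$ be an indeterminate (or a nonzero complex number that is not a root of unity) and $a$ a parameter. Define polynomials $B_k(x,a)$, $k\ge0$, by the expansion of formal power series in $z$ $$e(xz)=\sum_{k\ge0}\frac{B_k(x,a)}{[k]!}\,z^k\,E([k]az).$$ Then for every $n\ge1$, $$B_n(x,a)=x\,e(-[n]aD)\,x^{n-1}=x\sum_{j=0}^{n-1}(-1)^j\begin{bmatrix}n-1\\ j\end{bmatrix}a^jx^{n-1-j}[n]^j.$$
   Context: $[n]=\frac{1-q^n}{1-q}$, $[n]!=\prod_{j=1}^n[j]$, $\begin{bmatrix}n\\k\end{bmatrix}=\frac{[n]!}{[k]![n-k]!}$. $e(z)=\sum_{k\ge0}\frac{z^k}{[k]!}$, $E(z)=\sum_{k\ge0}q^{\binom{k}{2}}\frac{z^k}{[k]!}$. $D$ is the $q$-differentiation operator in $x$: $Df(x)=\frac{f(x)-f(qx)}{(1-q)x}$, and $e(cD)=\sum_k\frac{c^k}{[k]!}D^k$. -}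

module Defs where

open import Algebra.Bundles using (CommutativeRing)
open import Data.Nat as ℕ using (ℕ; zero; suc; _∸_)
open import Data.Nat.Combinatorics using (_C_)

-- q-calculus inside an arbitrary commutative ring R (polynomial identities in
-- Z[q,x,a] are exactly those holding for all q x a in all commutative rings).
module QCalc {c ℓ} (R : CommutativeRing c ℓ) where
  open CommutativeRing R

  pow : Carrier → ℕ → Carrier
  pow y zero    = 1#
  pow y (suc n) = y * pow y n

  sumTo : ℕ → (ℕ → Carrier) → Carrier
  sumTo zero    f = 0#
  sumTo (suc n) f = sumTo n f + f n

  qint : Carrier → ℕ → Carrier
  qint q n = sumTo n (λ i → pow q i)

  qbinom : Carrier → ℕ → ℕ → Carrier
  qbinom q zero    zero    = 1#
  qbinom q zero    (suc k) = 0#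
  qbinom q (suc n) zero    = 1#
  qbinom q (suc n) (suc k) = qbinom q n k + pow q (suc k) * qbinom q n (suc k)

  -- The defining expansion  e(xz) = Σ_k B_k/[k]! z^k E([k]az),
  -- compared coefficient of z^n and multiplied through by [n]!:
  --   x^n = Σ_{k=0}^{n} [n choose k] q^{C(n-k,2)} ([k] a)^{n-k} B_k
  IsBSeq : Carrier → Carrier → Carrier → (ℕ → Carrier) → Set ℓ
  IsBSeq q x a B = ∀ n →
    pow x n ≈ sumTo (suc n) (λ k →
      qbinom q n k * pow q ((n ∸ k) C 2) * pow (qint q k * a) (n ∸ k) * B k)

  BFormula : Carrier → Carrier → Carrier → ℕ → Carrier
  BFormula q x a n = x * sumTo n (λ j →
    pow (- 1#) j * qbinom q (n ∸ 1) j * pow a j * pow x (n ∸ 1 ∸ j) * pow (qint q n) j)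

-- Comparing coefficients of z^n, IsBSeq is a unitriangular linear system for
-- B, so it suffices that the closed form solves it. Substituting it into row
-- n and collecting powers of x, the coefficient of x^n is 1, and for p < n - 1
-- the coefficient of x^(p+1) becomes, after absorbing one factor [p+j+1] into
-- the q-binomials, an N-th q-difference (N = n - 1 - p) of the polynomial
-- u^(N-1) sampled at the q-integers [p+1], [p+2], ..., hence zero.
module Submission where

open import Algebra.Bundles using (CommutativeRing; RawRing)
open import Algebra.Solver.Ring.AlmostCommutativeRing using (fromCommutativeRing; _-Raw-AlmostCommutative⟶_)
open import Data.Maybe using (Maybe; just; nothing)
open import Data.Nat as ℕ using (ℕ; zero; suc; _∸_; _≤_; _<_; z≤n; s≤s)
import Data.Nat.Properties as ℕ
open import Data.Nat.Combinatorics using (_C_; nCk+nC[k+1]≡[n+1]C[k+1]; nC1≡n)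
open import Data.Nat.Induction using (<-rec)
open import Data.Product using (Σ-syntax; _×_; _,_)
open import Level using (0ℓ; _⊔_)
open import Relation.Binary.PropositionalEquality as ≡ using (_≡_)
open import Relation.Nullary using (yes; no)
open import Defs

module IntegerCoefficientSolver {c ℓ} (R : CommutativeRing c ℓ) where
  open CommutativeRing R
  open import Algebra.Properties.Ring ring
    using (-‿distribˡ-*; -‿distribʳ-*; -‿involutive; -‿+-comm; -0#≈0#; ⁻¹-anti-homo‿-)
  open import Algebra.Properties.Monoid.Mult +-monoid using (×-homo-+; ×-congˡ) renaming (_×_ to _·_)
  open import Algebra.Properties.Semiring.Mult semiring using (×1-homo-*)
  open import Relation.Binary.Reasoning.Setoid setoid
  import Algebra.Solver.Ring.NaturalCoefficients.Default commutativeSemiring as ℕ-Solver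
  open ℕ-Solver using (_:+_; _:*_; _:=_)

  ℤ-pairs : RawRing 0ℓ 0ℓ
  ℤ-pairs = record
    { Carrier = ℕ × ℕ
    ; _≈_     = _≡_
    ; _+_     = λ { (m , n) (m′ , n′) → m ℕ.+ m′ , n ℕ.+ n′ }
    ; _*_     = λ { (m , n) (m′ , n′) → m ℕ.* m′ ℕ.+ n ℕ.* n′ , m ℕ.* n′ ℕ.+ n ℕ.* m′ }
    ; -_      = λ { (m , n) → n , m }
    ; 0#      = 0 , 0
    ; 1#      = 1 , 0
    }

  ⟦_⟧ℤ : ℕ × ℕ → Carrier
  ⟦ m , n ⟧ℤ = m · 1# - n · 1#

  private
    sub-cong : ∀ {u u′ v v′} → u ≈ u′ → v ≈ v′ → u - v ≈ u′ - v′
    sub-cong u≈u′ v≈v′ = +-cong u≈u′ (-‿cong v≈v′)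

    sub-+-sub : ∀ u v s t → (u - v) + (s - t) ≈ (u + s) - (v + t)
    sub-+-sub u v s t = begin
      (u + - v) + (s + - t)
        ≈⟨ ℕ-Solver.solve 4 (λ u v′ s t′ → (u :+ v′) :+ (s :+ t′) := (u :+ s) :+ (v′ :+ t′)) refl u (- v) s (- t) ⟩
      (u + s) + (- v + - t) ≈⟨ +-congˡ (-‿+-comm v t) ⟩
      (u + s) - (v + t)     ∎

    sub-*-sub : ∀ u v s t → (u - v) * (s - t) ≈ (u * s + v * t) - (u * t + v * s)
    sub-*-sub u v s t = begin
      (u + - v) * (s + - t)
        ≈⟨ ℕ-Solver.solve 4 (λ u v′ s t′ → (u :+ v′) :* (s :+ t′) := (u :* s :+ v′ :* t′) :+ (u :* t′ :+ v′ :* s)) refl u (- v) s (- t) ⟩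
      (u * s + - v * - t) + (u * - t + - v * s)
        ≈⟨ +-cong (+-congˡ -v*-t≈v*t) (+-cong (sym (-‿distribʳ-* u t)) (sym (-‿distribˡ-* v s))) ⟩
      (u * s + v * t) + (- (u * t) + - (v * s)) ≈⟨ +-congˡ (-‿+-comm (u * t) (v * s)) ⟩
      (u * s + v * t) - (u * t + v * s)         ∎
      where
      -v*-t≈v*t : - v * - t ≈ v * t
      -v*-t≈v*t = trans (sym (-‿distribˡ-* v (- t)))
        (trans (-‿cong (sym (-‿distribʳ-* v t))) (-‿involutive (v * t)))

    sub≈sub : ∀ u v s t → u + t ≈ s + v → u - v ≈ s - t
    sub≈sub u v s t u+t≈s+v = begin
      u + - v                 ≈⟨ +-identityʳ _ ⟨
      (u + - v) + 0#          ≈⟨ +-congˡ (-‿inverseʳ t) ⟨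
      (u + - v) + (t + - t)   ≈⟨ ℕ-Solver.solve 4 (λ u v′ t t′ → (u :+ v′) :+ (t :+ t′) := (u :+ t) :+ (v′ :+ t′)) refl u (- v) t (- t) ⟩
      (u + t) + (- v + - t)   ≈⟨ +-congʳ u+t≈s+v ⟩
      (s + v) + (- v + - t)   ≈⟨ ℕ-Solver.solve 4 (λ s v v′ t′ → (s :+ v) :+ (v′ :+ t′) := (s :+ t′) :+ (v :+ v′)) refl s v (- v) (- t) ⟩
      (s + - t) + (v + - v)   ≈⟨ +-congˡ (-‿inverseʳ v) ⟩
      (s + - t) + 0#          ≈⟨ +-identityʳ _ ⟩
      s + - t                 ∎

  ⟦⟧ℤ-homomorphism : ℤ-pairs -Raw-AlmostCommutative⟶ fromCommutativeRing R
  ⟦⟧ℤ-homomorphism = record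
    { ⟦_⟧    = ⟦_⟧ℤ
    ; +-homo = λ { (m , n) (m′ , n′) → trans (sub-cong (×-homo-+ 1# m m′) (×-homo-+ 1# n n′)) (sym (sub-+-sub _ _ _ _)) }
    ; *-homo = λ { (m , n) (m′ , n′) → trans
        (sub-cong (trans (×-homo-+ 1# (m ℕ.* m′) (n ℕ.* n′)) (+-cong (×1-homo-* m m′) (×1-homo-* n n′)))
                 (trans (×-homo-+ 1# (m ℕ.* n′) (n ℕ.* m′)) (+-cong (×1-homo-* m n′) (×1-homo-* n m′))))
        (sym (sub-*-sub _ _ _ _)) }
    ; -‿homo = λ { (m , n) → sym (⁻¹-anti-homo‿- _ _) }
    ; 0-homo = -‿inverseʳ 0#
    ; 1-homo = trans (+-cong (+-identityʳ 1#) -0#≈0#) (+-identityʳ 1#)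
    }

  _≟ℤ_ : ∀ i j → Maybe (⟦ i ⟧ℤ ≈ ⟦ j ⟧ℤ)
  (m , n) ≟ℤ (m′ , n′) with m ℕ.+ n′ ℕ.≟ m′ ℕ.+ n
  ... | yes m+n′≡m′+n = just (sub≈sub _ _ _ _
          (trans (sym (×-homo-+ 1# m n′)) (trans (×-congˡ m+n′≡m′+n) (×-homo-+ 1# m′ n))))
  ... | no _ = nothing

  open import Algebra.Solver.Ring ℤ-pairs (fromCommutativeRing R) ⟦⟧ℤ-homomorphism _≟ℤ_ public

module SumProperties {c ℓ} (R : CommutativeRing c ℓ) where
  open CommutativeRing R
  open QCalc R
  open import Algebra.Properties.Ring ring using (-0#≈0#; -‿+-comm)
  open IntegerCoefficientSolver R using (solve; _:=_; _:+_)
  open import Relation.Binary.Reasoning.Setoid setoid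

  sumTo-cong : ∀ n {f g : ℕ → Carrier} → (∀ i → i < n → f i ≈ g i) → sumTo n f ≈ sumTo n g
  sumTo-cong zero    f≈g = refl
  sumTo-cong (suc n) f≈g = +-cong (sumTo-cong n (λ i i<n → f≈g i (ℕ.m<n⇒m<1+n i<n))) (f≈g n ℕ.≤-refl)

  sumTo-zero : ∀ n {f : ℕ → Carrier} → (∀ i → i < n → f i ≈ 0#) → sumTo n f ≈ 0#
  sumTo-zero zero    f≈0 = refl
  sumTo-zero (suc n) f≈0 =
    trans (+-cong (sumTo-zero n (λ i i<n → f≈0 i (ℕ.m<n⇒m<1+n i<n))) (f≈0 n ℕ.≤-refl)) (+-identityʳ 0#)

  sumTo-+ : ∀ n (f g : ℕ → Carrier) → sumTo n (λ i → f i + g i) ≈ sumTo n f + sumTo n g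
  sumTo-+ zero    f g = sym (+-identityʳ 0#)
  sumTo-+ (suc n) f g = trans (+-congʳ (sumTo-+ n f g))
    (solve 4 (λ F G u v → (F :+ G) :+ (u :+ v) := (F :+ u) :+ (G :+ v)) refl _ _ _ _)

  *-distribˡ-sumTo : ∀ n (k : Carrier) (f : ℕ → Carrier) → k * sumTo n f ≈ sumTo n (λ i → k * f i)
  *-distribˡ-sumTo zero    k f = zeroʳ k
  *-distribˡ-sumTo (suc n) k f = trans (distribˡ k _ _) (+-congʳ (*-distribˡ-sumTo n k f))

  -‿distrib-sumTo : ∀ n (f : ℕ → Carrier) → - sumTo n f ≈ sumTo n (λ i → - f i)
  -‿distrib-sumTo zero    f = -0#≈0#
  -‿distrib-sumTo (suc n) f = trans (sym (-‿+-comm _ _)) (+-congʳ (-‿distrib-sumTo n f))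

  sumTo-sucˡ : ∀ n (f : ℕ → Carrier) → sumTo (suc n) f ≈ f 0 + sumTo n (λ i → f (suc i))
  sumTo-sucˡ zero    f = trans (+-identityˡ _) (sym (+-identityʳ _))
  sumTo-sucˡ (suc n) f = trans (+-congʳ (sumTo-sucˡ n f)) (+-assoc _ _ _)

  sumTo-split : ∀ m k (f : ℕ → Carrier) → sumTo (m ℕ.+ k) f ≈ sumTo m f + sumTo k (λ i → f (m ℕ.+ i))
  sumTo-split m zero    f rewrite ℕ.+-identityʳ m = sym (+-identityʳ _)
  sumTo-split m (suc k) f rewrite ℕ.+-suc m k = trans (+-congʳ (sumTo-split m k f)) (+-assoc _ _ _)

  sumTo-truncate : ∀ {m n} (f : ℕ → Carrier) → m ≤ n → (∀ i → m ≤ i → f i ≈ 0#) → sumTo n f ≈ sumTo m f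
  sumTo-truncate {m} f m≤n f≈0 with ℕ.m≤n⇒∃[o]m+o≡n m≤n
  ... | d , ≡.refl = trans (sumTo-split m d f)
    (trans (+-congˡ (sumTo-zero d (λ i _ → f≈0 (m ℕ.+ i) (ℕ.m≤m+n m i)))) (+-identityʳ _))

  sumTo-swap : ∀ m n (g : ℕ → ℕ → Carrier) →
    sumTo m (λ i → sumTo n (λ j → g i j)) ≈ sumTo n (λ j → sumTo m (λ i → g i j))
  sumTo-swap zero    n g = sym (sumTo-zero n (λ _ _ → refl))
  sumTo-swap (suc m) n g = trans (+-congʳ (sumTo-swap m n g)) (sym (sumTo-+ n _ _))

  sumTo-shift : ∀ n j (f : ℕ → Carrier) → (∀ k → k < j → f k ≈ 0#) → (∀ k → n ≤ k → f k ≈ 0#) →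
    sumTo n f ≈ sumTo n (λ p → f (p ℕ.+ j))
  sumTo-shift n j f f<j≈0 f≥n≈0 = begin
    sumTo n f                               ≈⟨ sumTo-truncate f (ℕ.m≤n+m n j) f≥n≈0 ⟨
    sumTo (j ℕ.+ n) f                       ≈⟨ sumTo-split j n f ⟩
    sumTo j f + sumTo n (λ i → f (j ℕ.+ i)) ≈⟨ +-cong (sumTo-zero j f<j≈0) (sumTo-cong n (λ i _ → reflexive (≡.cong f (ℕ.+-comm j i)))) ⟩
    0# + sumTo n (λ p → f (p ℕ.+ j))        ≈⟨ +-identityˡ _ ⟩
    sumTo n (λ p → f (p ℕ.+ j))             ∎

module PowerProperties {c ℓ} (R : CommutativeRing c ℓ) where
  open CommutativeRing R
  open QCalc R
  open IntegerCoefficientSolver R using (solve; _:=_; _:*_)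
  open import Relation.Binary.Reasoning.Setoid setoid

  pow-cong : ∀ {u v} n → u ≈ v → pow u n ≈ pow v n
  pow-cong zero    u≈v = refl
  pow-cong (suc n) u≈v = *-cong u≈v (pow-cong n u≈v)

  pow-+ : ∀ y m n → pow y (m ℕ.+ n) ≈ pow y m * pow y n
  pow-+ y zero    n = sym (*-identityˡ _)
  pow-+ y (suc m) n = trans (*-congˡ (pow-+ y m n)) (sym (*-assoc _ _ _))

  pow-* : ∀ y z n → pow (y * z) n ≈ pow y n * pow z n
  pow-* y z zero    = sym (*-identityˡ 1#)
  pow-* y z (suc n) = trans (*-congˡ (pow-* y z n))
    (solve 4 (λ y z A B → (y :* z) :* (A :* B) := (y :* A) :* (z :* B)) refl _ _ _ _)

  suc-C-2 : ∀ e → suc e C 2 ≡ e ℕ.+ e C 2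
  suc-C-2 e = ≡.trans (≡.sym (nCk+nC[k+1]≡[n+1]C[k+1] e 1)) (≡.cong (ℕ._+ e C 2) (nC1≡n e))

  pow-suc-C-2 : ∀ y e → pow y (suc e C 2) ≈ pow y e * pow y (e C 2)
  pow-suc-C-2 y e = trans (reflexive (≡.cong (pow y) (suc-C-2 e))) (pow-+ y e (e C 2))

  pow-C-2-shift : ∀ y {N j} → j < N → pow y (suc j) * pow y ((N ∸ j) C 2) ≈ pow y N * pow y ((N ∸ suc j) C 2)
  pow-C-2-shift y {j = j} j<N with ℕ.m≤n⇒∃[o]m+o≡n j<N
  ... | e , ≡.refl = begin
    pow y (suc j) * pow y ((suc (j ℕ.+ e) ∸ j) C 2)
      ≈⟨ *-congˡ (reflexive (≡.cong (λ t → pow y (t C 2)) (≡.trans (≡.cong (_∸ j) (≡.sym (ℕ.+-suc j e))) (ℕ.m+n∸m≡n j (suc e))))) ⟩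
    pow y (suc j) * pow y (suc e C 2)               ≈⟨ *-congˡ (pow-suc-C-2 y e) ⟩
    pow y (suc j) * (pow y e * pow y (e C 2))       ≈⟨ *-assoc _ _ _ ⟨
    (pow y (suc j) * pow y e) * pow y (e C 2)       ≈⟨ *-congʳ (pow-+ y (suc j) e) ⟨
    pow y (suc j ℕ.+ e) * pow y (e C 2)
      ≈⟨ *-congˡ (reflexive (≡.cong (λ t → pow y (t C 2)) (≡.sym (ℕ.m+n∸m≡n j e)))) ⟩
    pow y (suc j ℕ.+ e) * pow y ((suc j ℕ.+ e ∸ suc j) C 2) ∎

module QBinomialProperties {c ℓ} (R : CommutativeRing c ℓ) (q : CommutativeRing.Carrier R) where
  open CommutativeRing R
  open QCalc R
  open PowerProperties R using (pow-+)
  open IntegerCoefficientSolver R using (solve; _:=_; _:+_; _:*_)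
  open import Relation.Binary.Reasoning.Setoid setoid

  qint-suc : ∀ n → qint q (suc n) ≈ 1# + q * qint q n
  qint-suc zero    = trans (+-identityˡ _) (sym (trans (+-congˡ (zeroʳ q)) (+-identityʳ _)))
  qint-suc (suc n) = begin
    qint q (suc n) + pow q (suc n)     ≈⟨ +-congʳ (qint-suc n) ⟩
    (1# + q * qint q n) + q * pow q n  ≈⟨ solve 4 (λ o q A B → (o :+ q :* A) :+ q :* B := o :+ q :* (A :+ B)) refl 1# q (qint q n) (pow q n) ⟩
    1# + q * (qint q n + pow q n)      ∎

  qbinom-0 : ∀ n → qbinom q n 0 ≈ 1#
  qbinom-0 zero    = refl
  qbinom-0 (suc n) = refl

  qbinom-> : ∀ {n k} → n < k → qbinom q n k ≈ 0#
  qbinom-> {zero}  {suc k} _         = refl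
  qbinom-> {suc n} {suc k} (s≤s n<k) =
    trans (+-cong (qbinom-> n<k) (*-congˡ (qbinom-> (ℕ.m<n⇒m<1+n n<k)))) (trans (+-identityˡ _) (zeroʳ _))

  qbinom-diag : ∀ n → qbinom q n n ≈ 1#
  qbinom-diag zero    = refl
  qbinom-diag (suc n) = trans (+-cong (qbinom-diag n) (*-congˡ (qbinom-> {n} ℕ.≤-refl)))
    (trans (+-congˡ (zeroʳ _)) (+-identityʳ _))

  -- gauss a b = [a+b choose a]: the q-Pascal rule of qbinom in coordinates
  -- where both symmetry and the trinomial identity go by structural recursion.
  gauss : ℕ → ℕ → Carrier
  gauss zero    b       = 1#
  gauss (suc a) zero    = 1#
  gauss (suc a) (suc b) = gauss a (suc b) + pow q (suc a) * gauss (suc a) b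

  qbinom≈gauss : ∀ a b → qbinom q (a ℕ.+ b) a ≈ gauss a b
  qbinom≈gauss zero    b       = qbinom-0 b
  qbinom≈gauss (suc a) zero    = trans (reflexive (≡.cong (λ n → qbinom q (suc n) (suc a)) (ℕ.+-identityʳ a))) (qbinom-diag (suc a))
  qbinom≈gauss (suc a) (suc b) = +-cong (qbinom≈gauss a (suc b))
    (*-congˡ (trans (reflexive (≡.cong (λ n → qbinom q n (suc a)) (ℕ.+-suc a b))) (qbinom≈gauss (suc a) b)))

  gauss-1ˡ : ∀ n → gauss 1 n ≈ qint q (suc n)
  gauss-1ˡ zero    = sym (+-identityˡ _)
  gauss-1ˡ (suc n) = begin
    1# + pow q 1 * gauss 1 n    ≈⟨ +-congˡ (*-cong (*-identityʳ q) (gauss-1ˡ n)) ⟩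
    1# + q * qint q (suc n)     ≈⟨ qint-suc (suc n) ⟨
    qint q (suc (suc n))        ∎

  gauss-1ʳ : ∀ a → gauss a 1 ≈ qint q (suc a)
  gauss-1ʳ zero    = sym (+-identityˡ _)
  gauss-1ʳ (suc a) = +-cong (gauss-1ʳ a) (*-identityʳ _)

  gauss-pascal′ : ∀ a b → gauss (suc a) (suc b) ≈ pow q (suc b) * gauss a (suc b) + gauss (suc a) b
  gauss-pascal′ zero b = begin
    gauss 1 (suc b)                  ≈⟨ gauss-1ˡ (suc b) ⟩
    qint q (suc b) + pow q (suc b)   ≈⟨ +-comm _ _ ⟩
    pow q (suc b) + qint q (suc b)   ≈⟨ +-cong (*-identityʳ _) (gauss-1ˡ b) ⟨
    pow q (suc b) * 1# + gauss 1 b   ∎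
  gauss-pascal′ (suc a) zero = begin
    gauss (suc a) 1 + pow q (suc (suc a)) * 1#  ≈⟨ +-cong (gauss-1ʳ (suc a)) (*-identityʳ _) ⟩
    qint q (suc (suc a)) + pow q (suc (suc a))  ≈⟨ qint-suc (suc (suc a)) ⟩
    1# + q * qint q (suc (suc a))               ≈⟨ +-comm _ _ ⟩
    q * qint q (suc (suc a)) + 1#               ≈⟨ +-congʳ (*-cong (*-identityʳ q) (gauss-1ʳ (suc a))) ⟨
    (q * 1#) * gauss (suc a) 1 + 1#             ∎
  gauss-pascal′ (suc a) (suc b) = begin
    gauss (suc a) (suc (suc b)) + pow q (suc (suc a)) * gauss (suc (suc a)) (suc b)
      ≈⟨ +-cong (gauss-pascal′ a (suc b)) (*-congˡ (gauss-pascal′ (suc a) b)) ⟩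
    (pow q (suc (suc b)) * gauss a (suc (suc b)) + gauss (suc a) (suc b))
      + pow q (suc (suc a)) * (pow q (suc b) * gauss (suc a) (suc b) + gauss (suc (suc a)) b)
      ≈⟨ solve 6 (λ q A B X Y Z → (q :* (q :* B) :* X :+ Y) :+ q :* (q :* A) :* (q :* B :* Y :+ Z)
                                   := q :* (q :* B) :* (X :+ q :* A :* Y) :+ (Y :+ q :* (q :* A) :* Z))
           refl q (pow q a) (pow q b) (gauss a (suc (suc b))) (gauss (suc a) (suc b)) (gauss (suc (suc a)) b) ⟩
    pow q (suc (suc b)) * gauss (suc a) (suc (suc b)) + gauss (suc (suc a)) (suc b)
      ∎

  gauss-sym : ∀ a b → gauss a b ≈ gauss b a
  gauss-sym zero    zero    = refl
  gauss-sym zero    (suc b) = refl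
  gauss-sym (suc a) zero    = refl
  gauss-sym (suc a) (suc b) = begin
    gauss a (suc b) + pow q (suc a) * gauss (suc a) b  ≈⟨ +-cong (gauss-sym a (suc b)) (*-congˡ (gauss-sym (suc a) b)) ⟩
    gauss (suc b) a + pow q (suc a) * gauss b (suc a)  ≈⟨ +-comm _ _ ⟩
    pow q (suc a) * gauss b (suc a) + gauss (suc b) a  ≈⟨ gauss-pascal′ b a ⟨
    gauss (suc b) (suc a)                              ∎

  gauss-trinomial : ∀ a b c → gauss (a ℕ.+ b) c * gauss a b ≈ gauss a (b ℕ.+ c) * gauss b c
  gauss-trinomial zero    b       c       = *-comm _ _
  gauss-trinomial (suc a) zero    c       = *-congʳ (reflexive (≡.cong (λ n → gauss (suc n) c) (ℕ.+-identityʳ a)))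
  gauss-trinomial (suc a) (suc b) zero    =
    trans (*-comm _ _) (*-congʳ (reflexive (≡.cong (λ n → gauss (suc a) (suc n)) (≡.sym (ℕ.+-identityʳ b)))))
  gauss-trinomial (suc a) (suc b) (suc c) = begin
    (X + pAB * W) * (Y + pA * Z)
      ≈⟨ solve 6 (λ X W Y Z pA pAB → (X :+ pAB :* W) :* (Y :+ pA :* Z)
                                     := X :* Y :+ pA :* (X :* Z) :+ pAB :* (W :* (Y :+ pA :* Z)))
           refl X W Y Z pA pAB ⟩
    X * Y + pA * (X * Z) + pAB * (W * (Y + pA * Z))
      ≈⟨ +-cong (+-cong (gauss-trinomial a (suc b) (suc c))
                        (*-congˡ (trans (*-congʳ (reflexive (≡.cong (λ n → gauss n (suc c)) (ℕ.+-suc a b)))) (gauss-trinomial (suc a) b (suc c)))))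
                (*-cong (pow-+ q (suc a) (suc b))
                        (trans (gauss-trinomial (suc a) (suc b) c) (*-congʳ (reflexive (≡.cong (gauss (suc a)) (≡.sym (ℕ.+-suc b c))))))) ⟩
    U * (V + pB * T) + pA * (Y′ * V) + (pA * pB) * (Y′ * T)
      ≈⟨ solve 6 (λ U V T Y′ pA pB → U :* (V :+ pB :* T) :+ pA :* (Y′ :* V) :+ (pA :* pB) :* (Y′ :* T)
                                     := (U :+ pA :* Y′) :* (V :+ pB :* T))
           refl U V T Y′ pA pB ⟩
    (U + pA * Y′) * (V + pB * T)
      ∎
    where
    X = gauss (a ℕ.+ suc b) (suc c)
    W = gauss (suc (a ℕ.+ suc b)) c
    Y = gauss a (suc b)
    Z = gauss (suc a) b
    pA = pow q (suc a)
    pB = pow q (suc b)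
    pAB = pow q (suc (a ℕ.+ suc b))
    U = gauss a (suc (b ℕ.+ suc c))
    Y′ = gauss (suc a) (b ℕ.+ suc c)
    V = gauss b (suc c)
    T = gauss (suc b) c

  qbinom-revision : ∀ p N j → j ≤ N →
    qbinom q (suc (p ℕ.+ N)) (suc (p ℕ.+ j)) * qbinom q (p ℕ.+ j) j * qint q (suc (p ℕ.+ j))
      ≈ qint q (suc p) * qbinom q (suc (p ℕ.+ N)) (suc p) * qbinom q N j
  qbinom-revision p N j j≤N with ℕ.m≤n⇒∃[o]m+o≡n j≤N
  ... | c , ≡.refl = begin
    qbinom q (suc (p ℕ.+ (j ℕ.+ c))) (suc (p ℕ.+ j)) * qbinom q (p ℕ.+ j) j * qint q (suc (p ℕ.+ j))
      ≈⟨ *-cong (*-cong (trans (reflexive (≡.cong (λ n → qbinom q (suc n) (suc (p ℕ.+ j))) (≡.sym (ℕ.+-assoc p j c))))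
                               (qbinom≈gauss (suc (p ℕ.+ j)) c))
                        (trans (reflexive (≡.cong (λ n → qbinom q n j) (ℕ.+-comm p j))) (trans (qbinom≈gauss j p) (gauss-sym j p))))
                (sym (gauss-1ˡ (p ℕ.+ j))) ⟩
    A * gauss p j * gauss 1 (p ℕ.+ j)
      ≈⟨ solve 3 (λ A B C → A :* B :* C := A :* (C :* B)) refl A (gauss p j) (gauss 1 (p ℕ.+ j)) ⟩
    A * (gauss 1 (p ℕ.+ j) * gauss p j)  ≈⟨ *-congˡ (gauss-trinomial 1 p j) ⟨
    A * (gauss (suc p) j * gauss 1 p)    ≈⟨ *-assoc _ _ _ ⟨
    (A * gauss (suc p) j) * gauss 1 p    ≈⟨ *-congʳ (gauss-trinomial (suc p) j c) ⟩
    (gauss (suc p) (j ℕ.+ c) * gauss j c) * gauss 1 p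
      ≈⟨ solve 3 (λ A B C → A :* B :* C := C :* A :* B) refl (gauss (suc p) (j ℕ.+ c)) (gauss j c) (gauss 1 p) ⟩
    gauss 1 p * gauss (suc p) (j ℕ.+ c) * gauss j c
      ≈⟨ *-cong (*-cong (gauss-1ˡ p) (sym (qbinom≈gauss (suc p) (j ℕ.+ c)))) (sym (qbinom≈gauss j c)) ⟩
    qint q (suc p) * qbinom q (suc (p ℕ.+ (j ℕ.+ c))) (suc p) * qbinom q (j ℕ.+ c) j
      ∎
    where
    A = gauss (suc (p ℕ.+ j)) c

module PolynomialFunctions {c ℓ} (R : CommutativeRing c ℓ) where
  open CommutativeRing R
  open QCalc R
  open PowerProperties R using (pow-cong)
  open IntegerCoefficientSolver R using (solve; _:=_; _:+_; _:*_; _:-_)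
  open import Algebra.Properties.Ring ring using (-1*x≈-x)

  -- g is a polynomial function of degree < d, presented by peeling off the
  -- coefficient of u ^ (d - 1).
  DegreeBelow : ℕ → (Carrier → Carrier) → Set (c ⊔ ℓ)
  DegreeBelow zero    g = ∀ u → g u ≈ 0#
  DegreeBelow (suc d) g =
    Σ[ k ∈ Carrier ] Σ[ h ∈ (Carrier → Carrier) ] DegreeBelow d h × (∀ u → g u ≈ k * pow u d + h u)

  DegreeBelow-≗ : ∀ d {g g′ : Carrier → Carrier} → (∀ u → g u ≈ g′ u) → DegreeBelow d g → DegreeBelow d g′
  DegreeBelow-≗ zero    g≈g′ g≈0             u = trans (sym (g≈g′ u)) (g≈0 u)
  DegreeBelow-≗ (suc d) g≈g′ (k , h , dh , g≈) = k , h , dh , λ u → trans (sym (g≈g′ u)) (g≈ u)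

  DegreeBelow⇒cong : ∀ d {g : Carrier → Carrier} → DegreeBelow d g → ∀ {u v} → u ≈ v → g u ≈ g v
  DegreeBelow⇒cong zero    g≈0 {u} {v} _ = trans (g≈0 u) (sym (g≈0 v))
  DegreeBelow⇒cong (suc d) (k , h , dh , g≈) {u} {v} u≈v =
    trans (g≈ u) (trans (+-cong (*-congˡ (pow-cong d u≈v)) (DegreeBelow⇒cong d dh u≈v)) (sym (g≈ v)))

  DegreeBelow-0# : ∀ d → DegreeBelow d (λ _ → 0#)
  DegreeBelow-0# zero    u = refl
  DegreeBelow-0# (suc d) = 0# , (λ _ → 0#) , DegreeBelow-0# d , λ u → sym (trans (+-congʳ (zeroˡ _)) (+-identityʳ 0#))

  DegreeBelow-suc : ∀ d {g : Carrier → Carrier} → DegreeBelow d g → DegreeBelow (suc d) g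
  DegreeBelow-suc d {g} dg = 0# , g , dg , λ u → sym (trans (+-congʳ (zeroˡ _)) (+-identityˡ _))

  DegreeBelow-pow : ∀ d → DegreeBelow (suc d) (λ u → pow u d)
  DegreeBelow-pow d = 1# , (λ _ → 0#) , DegreeBelow-0# d , λ u → sym (trans (+-identityʳ _) (*-identityˡ _))

  DegreeBelow-+ : ∀ d {g h : Carrier → Carrier} → DegreeBelow d g → DegreeBelow d h → DegreeBelow d (λ u → g u + h u)
  DegreeBelow-+ zero    g≈0 h≈0 u = trans (+-cong (g≈0 u) (h≈0 u)) (+-identityʳ 0#)
  DegreeBelow-+ (suc d) (k₁ , h₁ , d₁ , g≈) (k₂ , h₂ , d₂ , h≈) =
    k₁ + k₂ , (λ u → h₁ u + h₂ u) , DegreeBelow-+ d d₁ d₂ ,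
    λ u → trans (+-cong (g≈ u) (h≈ u))
      (solve 5 (λ k₁ k₂ P A B → k₁ :* P :+ A :+ (k₂ :* P :+ B) := (k₁ :+ k₂) :* P :+ (A :+ B)) refl k₁ k₂ (pow u d) (h₁ u) (h₂ u))

  DegreeBelow-*ˡ : ∀ d α {g : Carrier → Carrier} → DegreeBelow d g → DegreeBelow d (λ u → α * g u)
  DegreeBelow-*ˡ zero    α g≈0               u = trans (*-congˡ (g≈0 u)) (zeroʳ α)
  DegreeBelow-*ˡ (suc d) α (k , h , dh , g≈) =
    α * k , (λ u → α * h u) , DegreeBelow-*ˡ d α dh ,
    λ u → trans (*-congˡ (g≈ u)) (solve 4 (λ α k P H → α :* (k :* P :+ H) := α :* k :* P :+ α :* H) refl α k (pow u d) (h u))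

  DegreeBelow-neg : ∀ d {g : Carrier → Carrier} → DegreeBelow d g → DegreeBelow d (λ u → - g u)
  DegreeBelow-neg d dg = DegreeBelow-≗ d (λ u → -1*x≈-x _) (DegreeBelow-*ˡ d (- 1#) dg)

  DegreeBelow-id* : ∀ d {h : Carrier → Carrier} → DegreeBelow d h → DegreeBelow (suc d) (λ u → u * h u)
  DegreeBelow-id* zero    h≈0 =
    DegreeBelow-suc 0 (λ u → trans (*-congˡ (h≈0 u)) (zeroʳ u))
  DegreeBelow-id* (suc d) (k , h , dh , h≈) =
    k , (λ u → u * h u) , DegreeBelow-id* d dh ,
    λ u → trans (*-congˡ (h≈ u)) (solve 4 (λ u k P H → u :* (k :* P :+ H) := k :* (u :* P) :+ u :* H) refl u k (pow u d) (h u))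

  module AffineSubstitution (α β : Carrier) where

    DegreeBelow-binomial : ∀ N → DegreeBelow N (λ u → pow (α + β * u) N - pow β N * pow u N)
    DegreeBelow-binomial zero    u = trans (+-congˡ (-‿cong (*-identityˡ 1#))) (-‿inverseʳ 1#)
    DegreeBelow-binomial (suc N) = DegreeBelow-≗ (suc N) expand
      (DegreeBelow-+ (suc N) (DegreeBelow-+ (suc N) (DegreeBelow-suc N (DegreeBelow-*ˡ N α ih))
                                                    (DegreeBelow-*ˡ (suc N) β (DegreeBelow-id* N ih)))
                             (DegreeBelow-*ˡ (suc N) (α * pow β N) (DegreeBelow-pow N)))
      where
      ih = DegreeBelow-binomial N
      expand : ∀ u → (α * (pow (α + β * u) N - pow β N * pow u N) + β * (u * (pow (α + β * u) N - pow β N * pow u N)))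
                       + α * pow β N * pow u N
                     ≈ (α + β * u) * pow (α + β * u) N - β * pow β N * (u * pow u N)
      expand u = solve 6 (λ α β u P Q U → (α :* (P :- Q :* U) :+ β :* (u :* (P :- Q :* U))) :+ α :* Q :* U
                                          := (α :+ β :* u) :* P :- β :* Q :* (u :* U))
                   refl α β u (pow (α + β * u) N) (pow β N) (pow u N)

    DegreeBelow-∘ : ∀ d {g : Carrier → Carrier} → DegreeBelow d g → DegreeBelow d (λ u → g (α + β * u))
    DegreeBelow-∘ zero    g≈0               u = g≈0 _
    DegreeBelow-∘ (suc d) (k , h , dh , g≈) =
      k * pow β d , (λ u → k * (pow (α + β * u) d - pow β d * pow u d) + h (α + β * u)) ,
      DegreeBelow-+ d (DegreeBelow-*ˡ d k (DegreeBelow-binomial d)) (DegreeBelow-∘ d dh) ,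
      λ u → trans (g≈ (α + β * u))
        (solve 5 (λ k P Q U H → k :* P :+ H := (k :* Q) :* U :+ (k :* (P :- Q :* U) :+ H))
           refl k (pow (α + β * u) d) (pow β d) (pow u d) (h (α + β * u)))

    -- The leading terms k β^N u^N cancel.
    DegreeBelow-difference : ∀ N {g : Carrier → Carrier} → DegreeBelow (suc N) g →
      DegreeBelow N (λ u → pow β N * g u - g (α + β * u))
    DegreeBelow-difference N {g} (k , h , dh , g≈) = DegreeBelow-≗ N expand
      (DegreeBelow-+ N (DegreeBelow-+ N (DegreeBelow-*ˡ N (pow β N) dh) (DegreeBelow-neg N (DegreeBelow-∘ N dh)))
                       (DegreeBelow-neg N (DegreeBelow-*ˡ N k (DegreeBelow-binomial N))))
      where
      expand : ∀ u → (pow β N * h u - h (α + β * u)) - k * (pow (α + β * u) N - pow β N * pow u N)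
                     ≈ pow β N * g u - g (α + β * u)
      expand u = sym (trans (+-cong (*-congˡ (g≈ u)) (-‿cong (g≈ (α + β * u))))
        (solve 6 (λ Q k U H P H′ → Q :* (k :* U :+ H) :- (k :* P :+ H′) := (Q :* H :- H′) :- k :* (P :- Q :* U))
           refl (pow β N) k (pow u N) (h u) (pow (α + β * u) N) (h (α + β * u))))

module AlternatingSum {c ℓ} (R : CommutativeRing c ℓ) (q : CommutativeRing.Carrier R) where
  open CommutativeRing R
  open QCalc R
  open SumProperties R
  open PowerProperties R using (pow-suc-C-2; pow-C-2-shift)
  open QBinomialProperties R q using (qbinom-0; qbinom->)
  open PolynomialFunctions R
  open AffineSubstitution 1# q
  open IntegerCoefficientSolver R using (solve; _:=_; _:+_; _:*_; _:-_; :-_)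
  open import Algebra.Properties.Ring ring using (-1*x≈-x)
  open import Relation.Binary.Reasoning.Setoid setoid

  alternatingCoeff : ℕ → ℕ → Carrier
  alternatingCoeff N j = pow (- 1#) j * qbinom q N j * pow q ((N ∸ j) C 2)

  alternatingSum : ℕ → (ℕ → Carrier) → Carrier
  alternatingSum N f = sumTo (suc N) (λ j → alternatingCoeff N j * f j)

  alternatingSum-cong : ∀ N {f g : ℕ → Carrier} → (∀ j → f j ≈ g j) → alternatingSum N f ≈ alternatingSum N g
  alternatingSum-cong N f≈g = sumTo-cong (suc N) (λ j _ → *-congˡ (f≈g j))

  alternatingSum-linear : ∀ N α (f g : ℕ → Carrier) →
    alternatingSum N (λ j → α * f j - g j) ≈ α * alternatingSum N f - alternatingSum N g
  alternatingSum-linear N α f g = begin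
    alternatingSum N (λ j → α * f j - g j)
      ≈⟨ sumTo-cong (suc N) (λ j _ → solve 4 (λ w α x y → w :* (α :* x :- y) := α :* (w :* x) :+ (:- (w :* y))) refl (w j) α (f j) (g j)) ⟩
    sumTo (suc N) (λ j → α * (w j * f j) + - (w j * g j))              ≈⟨ sumTo-+ (suc N) _ _ ⟩
    sumTo (suc N) (λ j → α * (w j * f j)) + sumTo (suc N) (λ j → - (w j * g j))
      ≈⟨ +-cong (*-distribˡ-sumTo (suc N) α _) (-‿distrib-sumTo (suc N) _) ⟨
    α * alternatingSum N f - alternatingSum N g                        ∎
    where
    w = alternatingCoeff N

  -- From the q-Pascal rule [N+1, j+1] = [N, j] + q^(j+1) [N, j+1].
  alternatingSum-suc : ∀ N (f : ℕ → Carrier) →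
    alternatingSum (suc N) f ≈ pow q N * alternatingSum N f - alternatingSum N (λ j → f (suc j))
  alternatingSum-suc N f = begin
    alternatingSum (suc N) f                                       ≈⟨ sumTo-sucˡ (suc N) _ ⟩
    h 0 + sumTo (suc N) (λ j → h (suc j))
      ≈⟨ +-congˡ (trans (sumTo-cong (suc N) (λ j _ → h-suc j)) (sumTo-+ (suc N) _ _)) ⟩
    h 0 + (sumTo (suc N) (λ j → - (g′ j)) + (sumTo N r + r N))
      ≈⟨ +-cong h0 (+-cong (-‿distrib-sumTo (suc N) _) (sym (+-cong (sumTo-cong N r<N) r-top))) ⟨
    pow q N * g 0 + (- alternatingSum N (λ j → f (suc j)) + (sumTo N (λ j → pow q N * g (suc j)) + 0#))
      ≈⟨ +-congˡ (+-congˡ (trans (+-identityʳ _) (sym (*-distribˡ-sumTo N (pow q N) _)))) ⟩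
    pow q N * g 0 + (- alternatingSum N (λ j → f (suc j)) + pow q N * sumTo N (λ j → g (suc j)))
      ≈⟨ solve 4 (λ Q G₀ X Y → Q :* G₀ :+ (:- X :+ Q :* Y) := Q :* (G₀ :+ Y) :- X)
           refl (pow q N) (g 0) (alternatingSum N (λ j → f (suc j))) (sumTo N (λ j → g (suc j))) ⟩
    pow q N * (g 0 + sumTo N (λ j → g (suc j))) - alternatingSum N (λ j → f (suc j))
      ≈⟨ +-congʳ (*-congˡ (sumTo-sucˡ N g)) ⟨
    pow q N * alternatingSum N f - alternatingSum N (λ j → f (suc j)) ∎
    where
    h g g′ r : ℕ → Carrier
    h j = alternatingCoeff (suc N) j * f j
    g j = alternatingCoeff N j * f j
    g′ j = alternatingCoeff N j * f (suc j)
    r j = (- pow (- 1#) j) * (q * pow q j) * qbinom q N (suc j) * pow q ((N ∸ j) C 2) * f (suc j)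

    h0 : pow q N * g 0 ≈ h 0
    h0 = begin
      pow q N * (1# * qbinom q N 0 * pow q (N C 2) * f 0)
        ≈⟨ *-congˡ (*-congʳ (*-congʳ (*-congˡ (qbinom-0 N)))) ⟩
      pow q N * (1# * 1# * pow q (N C 2) * f 0)
        ≈⟨ solve 4 (λ o Q C F → Q :* (o :* o :* C :* F) := o :* o :* (Q :* C) :* F) refl 1# (pow q N) (pow q (N C 2)) (f 0) ⟩
      1# * 1# * (pow q N * pow q (N C 2)) * f 0  ≈⟨ *-congʳ (*-congˡ (pow-suc-C-2 q N)) ⟨
      1# * 1# * pow q (suc N C 2) * f 0          ∎

    h-suc : ∀ j → h (suc j) ≈ - g′ j + r j
    h-suc j = trans (*-congʳ (*-congʳ (*-congʳ (-1*x≈-x (pow (- 1#) j)))))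
      (solve 7 (λ s A B C F q Q → (:- s) :* (A :+ (q :* Q) :* B) :* C :* F := :- (s :* A :* C :* F) :+ (:- s) :* (q :* Q) :* B :* C :* F)
         refl (pow (- 1#) j) (qbinom q N j) (qbinom q N (suc j)) (pow q ((N ∸ j) C 2)) (f (suc j)) q (pow q j))

    r-top : r N ≈ 0#
    r-top = trans (*-congʳ (*-congʳ (*-congˡ (qbinom-> {N} ℕ.≤-refl))))
      (trans (*-congʳ (*-congʳ (zeroʳ _))) (trans (*-congʳ (zeroˡ _)) (zeroˡ _)))

    r<N : ∀ j → j < N → r j ≈ pow q N * g (suc j)
    r<N j j<N = begin
      (- s) * (q * pow q j) * B * Cⱼ * F
        ≈⟨ solve 5 (λ s Q B E F → (:- s) :* Q :* B :* E :* F := (:- s) :* B :* (Q :* E) :* F) refl s (q * pow q j) B Cⱼ F ⟩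
      (- s) * B * (pow q (suc j) * Cⱼ) * F     ≈⟨ *-congʳ (*-congˡ (pow-C-2-shift q j<N)) ⟩
      (- s) * B * (pow q N * Cⱼ₊₁) * F
        ≈⟨ solve 5 (λ s Q B E F → (:- s) :* B :* (Q :* E) :* F := Q :* ((:- s) :* B :* E :* F)) refl s (pow q N) B Cⱼ₊₁ F ⟩
      pow q N * ((- s) * B * Cⱼ₊₁ * F)          ≈⟨ *-congˡ (*-congʳ (*-congʳ (*-congʳ (-1*x≈-x s)))) ⟨
      pow q N * g (suc j)                     ∎
      where
      s = pow (- 1#) j
      B = qbinom q N (suc j)
      Cⱼ = pow q ((N ∸ j) C 2)
      Cⱼ₊₁ = pow q ((N ∸ suc j) C 2)
      F = f (suc j)

  -- Sampled along an orbit of u ↦ 1 + q u (such as the q-integers), the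
  -- alternating sum is an N-th q-difference, which kills polynomials of degree < N.
  alternatingSum-annihilates : ∀ N {g : Carrier → Carrier} (w : ℕ → Carrier) →
    (∀ j → w (suc j) ≈ 1# + q * w j) → DegreeBelow N g → alternatingSum N (λ j → g (w j)) ≈ 0#
  alternatingSum-annihilates zero    w w-suc g≈0 =
    trans (+-congˡ (trans (*-congˡ (g≈0 (w 0))) (zeroʳ _))) (+-identityʳ 0#)
  alternatingSum-annihilates (suc N) {g} w w-suc dg = begin
    alternatingSum (suc N) (λ j → g (w j))                                     ≈⟨ alternatingSum-suc N _ ⟩
    pow q N * alternatingSum N (λ j → g (w j)) - alternatingSum N (λ j → g (w (suc j)))
      ≈⟨ +-congˡ (-‿cong (alternatingSum-cong N (λ j → DegreeBelow⇒cong (suc N) dg (w-suc j)))) ⟩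
    pow q N * alternatingSum N (λ j → g (w j)) - alternatingSum N (λ j → g (1# + q * w j))
      ≈⟨ alternatingSum-linear N (pow q N) _ _ ⟨
    alternatingSum N (λ j → pow q N * g (w j) - g (1# + q * w j))
      ≈⟨ alternatingSum-annihilates N w w-suc (DegreeBelow-difference N dg) ⟩
    0#                                                                         ∎

module TriangularSystem {c ℓ} (R : CommutativeRing c ℓ) where
  open CommutativeRing R
  open QCalc R
  open SumProperties R using (sumTo-cong)
  open import Algebra.Properties.Ring ring using (+-cancelˡ)
  open import Relation.Binary.Reasoning.Setoid setoid

  unitriangular-injective : (W : ℕ → ℕ → Carrier) → (∀ n → W n n ≈ 1#) → (B F : ℕ → Carrier) →
    (∀ n → sumTo (suc n) (λ k → W n k * B k) ≈ sumTo (suc n) (λ k → W n k * F k)) →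
    ∀ n → B n ≈ F n
  unitriangular-injective W Wₙₙ≈1 B F WB≈WF = <-rec _ step
    where
    step : ∀ n → (∀ {k} → k < n → B k ≈ F k) → B n ≈ F n
    step n B<n≈F<n = begin
      B n            ≈⟨ *-identityˡ _ ⟨
      1# * B n       ≈⟨ *-congʳ (Wₙₙ≈1 n) ⟨
      W n n * B n    ≈⟨ +-cancelˡ _ _ _ lastTerms ⟩
      W n n * F n    ≈⟨ *-congʳ (Wₙₙ≈1 n) ⟩
      1# * F n       ≈⟨ *-identityˡ _ ⟩
      F n            ∎
      where
      lastTerms : sumTo n (λ k → W n k * F k) + W n n * B n ≈ sumTo n (λ k → W n k * F k) + W n n * F n
      lastTerms = trans (+-congʳ (sumTo-cong n (λ k k<n → *-congˡ (sym (B<n≈F<n k<n))))) (WB≈WF n)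

module Expansion {c ℓ} (R : CommutativeRing c ℓ) (q x a : CommutativeRing.Carrier R) where
  open CommutativeRing R
  open QCalc R
  open SumProperties R
  open PowerProperties R using (pow-+; pow-*)
  open QBinomialProperties R q using (qint-suc; qbinom-0; qbinom->; qbinom-diag; qbinom-revision)
  open PolynomialFunctions R using (DegreeBelow-pow)
  open AlternatingSum R q using (alternatingCoeff; alternatingSum; alternatingSum-annihilates)
  open IntegerCoefficientSolver R using (solve; _:=_; _:*_)
  open import Relation.Binary.Reasoning.Setoid setoid

  weight : ℕ → ℕ → Carrier
  weight n k = qbinom q n k * pow q ((n ∸ k) C 2) * pow (qint q k * a) (n ∸ k)

  -- BFormula q x a 0 is the empty sum x · 0, whereas IsBSeq forces B 0 = 1.
  closedForm : ℕ → Carrier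
  closedForm zero    = 1#
  closedForm (suc k) = BFormula q x a (suc k)

  summand : ℕ → ℕ → Carrier
  summand k j = pow (- 1#) j * qbinom q k j * pow a j * pow x (k ∸ j) * pow (qint q (suc k)) j

  -- term n k j is the j-th summand of closedForm (suc k) in the row n + 1;
  -- it carries the power x ^ (k - j + 1).
  term : ℕ → ℕ → ℕ → Carrier
  term n k j = weight (suc n) (suc k) * (x * summand k j)

  n<k⇒term≈0 : ∀ {n k} j → n < k → term n k j ≈ 0#
  n<k⇒term≈0 {n} {k} j n<k = trans (*-congʳ (*-congʳ (*-congʳ (qbinom-> {suc n} {suc k} (s≤s n<k)))))
    (trans (*-congʳ (*-congʳ (zeroˡ _))) (trans (*-congʳ (zeroˡ _)) (zeroˡ _)))

  k<j⇒term≈0 : ∀ n {k j} → k < j → term n k j ≈ 0#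
  k<j⇒term≈0 n k<j = trans (*-congˡ (*-congˡ (*-congʳ (*-congʳ (*-congʳ (*-congˡ (qbinom-> k<j)))))))
    (trans (*-congˡ (*-congˡ (trans (*-congʳ (*-congʳ (*-congʳ (zeroʳ _))))
                               (trans (*-congʳ (*-congʳ (zeroˡ _))) (trans (*-congʳ (zeroˡ _)) (zeroˡ _))))))
      (trans (*-congˡ (zeroʳ x)) (zeroʳ _)))

  -- The coefficient of x ^ (p + 1) in the expansion of row n + 1.
  diagonal : ℕ → ℕ → Carrier
  diagonal n p = sumTo (suc n) (λ j → term n (p ℕ.+ j) j)

  expansion-by-diagonals : ∀ n →
    sumTo (suc (suc n)) (λ k → weight (suc n) k * closedForm k) ≈ sumTo (suc n) (diagonal n)
  expansion-by-diagonals n = begin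
    sumTo (suc (suc n)) (λ k → weight (suc n) k * closedForm k)                      ≈⟨ sumTo-sucˡ (suc n) _ ⟩
    weight (suc n) 0 * 1# + sumTo (suc n) (λ k → weight (suc n) (suc k) * (x * sumTo (suc k) (summand k)))
      ≈⟨ +-cong weight₀≈0 (sumTo-cong (suc n) (λ k k≤n → row k k≤n)) ⟩
    0# + sumTo (suc n) (λ k → sumTo (suc n) (term n k))                              ≈⟨ +-identityˡ _ ⟩
    sumTo (suc n) (λ k → sumTo (suc n) (term n k))                                   ≈⟨ sumTo-swap (suc n) (suc n) _ ⟩
    sumTo (suc n) (λ j → sumTo (suc n) (λ k → term n k j))
      ≈⟨ sumTo-cong (suc n) (λ j _ → sumTo-shift (suc n) j (λ k → term n k j) (λ k → k<j⇒term≈0 n) (λ k → n<k⇒term≈0 j)) ⟩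
    sumTo (suc n) (λ j → sumTo (suc n) (λ p → term n (p ℕ.+ j) j))                  ≈⟨ sumTo-swap (suc n) (suc n) _ ⟩
    sumTo (suc n) (λ p → sumTo (suc n) (λ j → term n (p ℕ.+ j) j))                  ∎
    where
    weight₀≈0 : weight (suc n) 0 * 1# ≈ 0#
    weight₀≈0 = trans (*-identityʳ _) (trans (*-congˡ (trans (*-congʳ (zeroˡ a)) (zeroˡ _))) (zeroʳ _))

    row : ∀ k → k < suc n → weight (suc n) (suc k) * (x * sumTo (suc k) (summand k)) ≈ sumTo (suc n) (term n k)
    row k k≤n = trans (*-congˡ (*-distribˡ-sumTo (suc k) x _))
      (trans (*-distribˡ-sumTo (suc k) _ _) (sym (sumTo-truncate (term n k) k≤n (λ j → k<j⇒term≈0 n))))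

  diagonal-top : ∀ n → diagonal n n ≈ pow x (suc n)
  diagonal-top n = begin
    diagonal n n                                                    ≈⟨ sumTo-sucˡ n _ ⟩
    term n (n ℕ.+ 0) 0 + sumTo n (λ j → term n (n ℕ.+ suc j) (suc j))
      ≈⟨ +-cong (reflexive (≡.cong (λ k → term n k 0) (ℕ.+-identityʳ n)))
                (sumTo-zero n (λ j _ → n<k⇒term≈0 (suc j) (ℕ.m<m+n n (s≤s z≤n)))) ⟩
    term n n 0 + 0#                                                 ≈⟨ +-identityʳ _ ⟩
    term n n 0                                                      ≈⟨ leading ⟩
    pow x (suc n)                                                   ∎
    where
    leading : term n n 0 ≈ pow x (suc n)
    leading rewrite ℕ.n∸n≡0 n = begin
      (qbinom q (suc n) (suc n) * 1# * 1#) * (x * (1# * qbinom q n 0 * 1# * pow x n * 1#))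
        ≈⟨ *-cong (trans (*-identityʳ _) (trans (*-identityʳ _) (qbinom-diag (suc n))))
                  (*-congˡ (trans (*-identityʳ _) (*-congʳ (trans (*-identityʳ _) (trans (*-identityˡ _) (qbinom-0 n)))))) ⟩
      1# * (x * (1# * pow x n))   ≈⟨ trans (*-identityˡ _) (*-congˡ (*-identityˡ _)) ⟩
      pow x (suc n)               ∎

  term-diagonal : ∀ p N j → j ≤ N → term (p ℕ.+ N) (p ℕ.+ j) j ≈
    (pow x (suc p) * pow a N) * (pow (- 1#) j * (qbinom q (suc (p ℕ.+ N)) (suc (p ℕ.+ j)) * qbinom q (p ℕ.+ j) j)
                                 * pow q ((N ∸ j) C 2) * pow (qint q (suc (p ℕ.+ j))) N)
  term-diagonal p N j j≤N with ℕ.m≤n⇒∃[o]m+o≡n j≤N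
  ... | c , ≡.refl = begin
    (Q * pow q ((p ℕ.+ (j ℕ.+ c) ∸ (p ℕ.+ j)) C 2) * pow (w * a) (p ℕ.+ (j ℕ.+ c) ∸ (p ℕ.+ j)))
      * (x * (s * B * pow a j * pow x ((p ℕ.+ j) ∸ j) * pow w j))
      ≈⟨ *-cong (*-cong (*-congˡ (reflexive (≡.cong (λ t → pow q (t C 2)) excess)))
                        (trans (reflexive (≡.cong (pow (w * a)) excess)) (pow-* w a c)))
                (*-congˡ (*-congʳ (*-congˡ (reflexive (≡.cong (pow x) (ℕ.m+n∸n≡m p j)))))) ⟩
    (Q * pow q (c C 2) * (pow w c * pow a c)) * (x * (s * B * pow a j * pow x p * pow w j))
      ≈⟨ solve 10 (λ Q C wc ac x s B aj xp wj →
           (Q :* C :* (wc :* ac)) :* (x :* (s :* B :* aj :* xp :* wj)) := (x :* xp :* (aj :* ac)) :* (s :* (Q :* B) :* C :* (wj :* wc)))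
           refl Q (pow q (c C 2)) (pow w c) (pow a c) x s B (pow a j) (pow x p) (pow w j) ⟩
    (x * pow x p * (pow a j * pow a c)) * (s * (Q * B) * pow q (c C 2) * (pow w j * pow w c))
      ≈⟨ *-cong (*-congˡ (pow-+ a j c))
                (*-cong (*-congˡ (reflexive (≡.cong (λ t → pow q (t C 2)) (ℕ.m+n∸m≡n j c)))) (pow-+ w j c)) ⟨
    (pow x (suc p) * pow a (j ℕ.+ c)) * (s * (Q * B) * pow q (((j ℕ.+ c) ∸ j) C 2) * pow w (j ℕ.+ c)) ∎
    where
    Q = qbinom q (suc (p ℕ.+ (j ℕ.+ c))) (suc (p ℕ.+ j))
    B = qbinom q (p ℕ.+ j) j
    s = pow (- 1#) j
    w = qint q (suc (p ℕ.+ j))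
    excess : p ℕ.+ (j ℕ.+ c) ∸ (p ℕ.+ j) ≡ c
    excess = ≡.trans (≡.cong (_∸ (p ℕ.+ j)) (≡.sym (ℕ.+-assoc p j c))) (ℕ.m+n∸m≡n (p ℕ.+ j) c)

  diagonal-below-top : ∀ p N′ → diagonal (p ℕ.+ suc N′) p ≈ 0#
  diagonal-below-top p N′ = begin
    diagonal (p ℕ.+ N) p
      ≈⟨ sumTo-truncate _ (s≤s (ℕ.m≤n+m N p)) (λ j N<j → n<k⇒term≈0 j (ℕ.+-monoʳ-< p N<j)) ⟩
    sumTo (suc N) (λ j → term (p ℕ.+ N) (p ℕ.+ j) j)         ≈⟨ sumTo-cong (suc N) (λ j j<sN → factored j (ℕ.≤-pred j<sN)) ⟩
    sumTo (suc N) (λ j → K * (alternatingCoeff N j * pow (w j) N′)) ≈⟨ *-distribˡ-sumTo (suc N) K _ ⟨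
    K * alternatingSum N (λ j → pow (w j) N′)                  ≈⟨ *-congˡ (alternatingSum-annihilates N w w-suc (DegreeBelow-pow N′)) ⟩
    K * 0#                                                     ≈⟨ zeroʳ _ ⟩
    0#                                                         ∎
    where
    N = suc N′
    w : ℕ → Carrier
    w j = qint q (suc (p ℕ.+ j))
    w-suc : ∀ j → w (suc j) ≈ 1# + q * w j
    w-suc j = trans (reflexive (≡.cong (λ t → qint q (suc t)) (ℕ.+-suc p j))) (qint-suc (suc (p ℕ.+ j)))
    P = pow x (suc p) * pow a N
    Kq = qint q (suc p) * qbinom q (suc (p ℕ.+ N)) (suc p)
    K = P * Kq
    factored : ∀ j → j ≤ N → term (p ℕ.+ N) (p ℕ.+ j) j ≈ K * (alternatingCoeff N j * pow (w j) N′)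
    factored j j≤N = begin
      term (p ℕ.+ N) (p ℕ.+ j) j                         ≈⟨ term-diagonal p N j j≤N ⟩
      P * (s * (Q * B) * E * (w j * pow (w j) N′))
        ≈⟨ *-congˡ (solve 6 (λ s Q B E W V → s :* (Q :* B) :* E :* (W :* V) := s :* (Q :* B :* W) :* E :* V) refl s Q B E (w j) (pow (w j) N′)) ⟩
      P * (s * (Q * B * w j) * E * pow (w j) N′)         ≈⟨ *-congˡ (*-congʳ (*-congʳ (*-congˡ (qbinom-revision p N j j≤N)))) ⟩
      P * (s * (Kq * qbinom q N j) * E * pow (w j) N′)
        ≈⟨ solve 6 (λ P s Kq B E V → P :* (s :* (Kq :* B) :* E :* V) := (P :* Kq) :* (s :* B :* E :* V)) refl P s Kq (qbinom q N j) E (pow (w j) N′) ⟩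
      K * (alternatingCoeff N j * pow (w j) N′)          ∎
      where
      s = pow (- 1#) j
      Q = qbinom q (suc (p ℕ.+ N)) (suc (p ℕ.+ j))
      B = qbinom q (p ℕ.+ j) j
      E = pow q ((N ∸ j) C 2)

  closedForm-expansion : ∀ n → pow x n ≈ sumTo (suc n) (λ k → weight n k * closedForm k)
  closedForm-expansion zero    = sym (trans (+-identityˡ _) (trans (*-identityʳ _) (trans (*-identityʳ _) (*-identityʳ _))))
  closedForm-expansion (suc n) = sym (begin
    sumTo (suc (suc n)) (λ k → weight (suc n) k * closedForm k)  ≈⟨ expansion-by-diagonals n ⟩
    sumTo n (diagonal n) + diagonal n n                        ≈⟨ +-cong (sumTo-zero n below-top) (diagonal-top n) ⟩
    0# + pow x (suc n)                                         ≈⟨ +-identityˡ _ ⟩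
    pow x (suc n)                                              ∎)
    where
    below-top : ∀ p → p < n → diagonal n p ≈ 0#
    below-top p p<n with ℕ.m≤n⇒∃[o]m+o≡n p<n
    ... | o , ≡.refl = trans (reflexive (≡.cong (λ m → diagonal m p) (≡.sym (ℕ.+-suc p o)))) (diagonal-below-top p o)

  weight-diag : ∀ n → weight n n ≈ 1#
  weight-diag n rewrite ℕ.n∸n≡0 n = trans (*-identityʳ _) (trans (*-identityʳ _) (qbinom-diag n))

mainTheorem8 : ∀ {c ℓ} (R : CommutativeRing c ℓ) →
    let open CommutativeRing R
        open QCalc R
    in (q x a : Carrier) (B : ℕ → Carrier) → IsBSeq q x a B →
       (n : ℕ) → 1 ℕ.≤ n → B n ≈ BFormula q x a n
mainTheorem8 R q x a B isBSeq (suc n) _ =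
  unitriangular-injective weight weight-diag B closedForm
    (λ m → trans (sym (isBSeq m)) (closedForm-expansion m)) (suc n)
  where
  open CommutativeRing R
  open TriangularSystem R
  open Expansion R q x a
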